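{- For all integers $n \geq 3$ and $k \geq 1$, the cycle $C_n$ on $n$ vertices satisfies \[\gamma_{all,k}^\infty(C_n) = \gamma_k(C_n) = \Big\lceil \frac{n}{2k+1}\Big\rceil.\]
   Context: Graphs are finite and simple; $d(u,v)$ denotes graph distance, and $N_k[x]=\{v: d(x,v)\le k\}$. A multiset $D$ of vertices of $G$ is a distance-$k$ dominating set if every vertex of $V(G)\setminus D$ is at distance at most $k$ from some element of $D$; $\gamma_k(G)$ is the minimum cardinality of such a multiset. Let $\mathbb{D}_{k,q}(G)$ be the set of distance-$k$ dominating multisets of cardinality $q$. For $D=\{v_1,\dots,v_q\}$ and $D'=\{u_1,\dots,u_q\}$ in $\mathbb{D}_{k,q}(G)$, $D$ transforms to $D'$ if (for some indexing) $u_i\in N_k[v_i]$ for all $i$. An eternal distance-$k$ dominating family is a subset $\mathcal{E}\subseteq\mathbb{D}_{k,q}(G)$ for some $q$ such that for every $D\in\mathcal{E}$ and every vertex $v$ there is $D'\in\mathcal{E}$ with $v\in D'$ and $D$ transforms to $D'$. The eternal distance-$k$ domination number $\gamma_{all,k}^\infty(G)$ is the minimum $q$ for which an eternal distance-$k$ dominating family of $G$ (consisting of multisets of size $q$) exists. (Informally: guards occupy a distance-$k$ dominating multiset; after each attack on a vertex, every guard moves distance at most $k$ so that the new positions form a distance-$k$ dominating multiset containing the attacked vertex.) -}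

module Defs where

open import Data.Nat using (ℕ; zero; suc; _+_; _*_; _≤_)
open import Data.Nat.DivMod using (_/_)
open import Data.Fin using (Fin; toℕ)
open import Data.Fin.Permutation using (Permutation′; _⟨$⟩ʳ_)
open import Data.Vec using (Vec; lookup)
open import Data.Product using (Σ; ∃; ∃-syntax; _×_; _,_)
open import Data.Sum using (_⊎_)
open import Data.Empty using (⊥)
open import Relation.Nullary using (¬_)
open import Relation.Binary.PropositionalEquality using (_≡_)

-- A graph on the vertex set Fin n, given by its adjacency relation.
-- (Symmetry/looplessness are not needed by the definitions below; the
-- cycle C_n defined below is symmetric by construction and loopless for n ≥ 3.)
record Graph (n : ℕ) : Set₁ where
  field
    Adj   : Fin n → Fin n → Set
open Graph public

data Walk {n : ℕ} (G : Graph n) : ℕ → Fin n → Fin n → Set where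
  here : ∀ {u} → Walk G zero u u
  step : ∀ {m u v w} → Adj G u v → Walk G m v w → Walk G (suc m) u w

DistLe : ∀ {n} → Graph n → ℕ → Fin n → Fin n → Set
DistLe G k u v = ∃[ m ] (m ≤ k × Walk G m u v)

-- Multisets of q vertices are represented by vectors of length q
-- (the order of the entries is irrelevant for all notions below).
_∈ᴹ_ : ∀ {n q} → Fin n → Vec (Fin n) q → Set
v ∈ᴹ D = ∃[ i ] (lookup D i ≡ v)

IsDistDom : ∀ {n q} → Graph n → ℕ → Vec (Fin n) q → Set
IsDistDom G k D = ∀ v → ∃[ i ] DistLe G k (lookup D i) v

Transforms : ∀ {n q} → Graph n → ℕ → Vec (Fin n) q → Vec (Fin n) q → Set
Transforms {q = q} G k D D' =
  Σ (Permutation′ q) λ σ → ∀ i → DistLe G k (lookup D i) (lookup D' (σ ⟨$⟩ʳ i))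

IsEternalFamily : ∀ {n q} → Graph n → ℕ → (Vec (Fin n) q → Set) → Set
IsEternalFamily G k E =
  (∃[ D ] E D)
  × (∀ D → E D → IsDistDom G k D)
  × (∀ D → E D → ∀ v → ∃[ D' ] (E D' × v ∈ᴹ D' × Transforms G k D D'))

HasDistDom : ∀ {n} → Graph n → ℕ → ℕ → Set
HasDistDom {n} G k q = ∃[ D ] IsDistDom {n} {q} G k D

HasEternalFamily : ∀ {n} → Graph n → ℕ → ℕ → Set₁
HasEternalFamily {n} G k q = ∃[ E ] IsEternalFamily {n} {q} G k E

IsMinimum : ∀ {ℓ} → (ℕ → Set ℓ) → ℕ → Set ℓ
IsMinimum P m = P m × (∀ q → P q → m ≤ q)

DomNumberIs : ∀ {n} → Graph n → ℕ → ℕ → Set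
DomNumberIs G k m = IsMinimum (HasDistDom G k) m

EternalDomNumberIs : ∀ {n} → Graph n → ℕ → ℕ → Set₁
EternalDomNumberIs G k m = IsMinimum (HasEternalFamily G k) m

CycleAdj : (n : ℕ) → Fin n → Fin n → Set
CycleAdj n i j = Succ i j ⊎ Succ j i
  where
  Succ : Fin n → Fin n → Set
  Succ a b = (toℕ b ≡ suc (toℕ a)) ⊎ (suc (toℕ a) ≡ n × toℕ b ≡ 0)

Cycle : (n : ℕ) → Graph n
Cycle n = record { Adj = CycleAdj n }

ceilDiv : ℕ → ℕ → ℕ
ceilDiv n k = (n + 2 * k) / suc (2 * k)

module Submission where

-- With s = 2k+1, the k-ball around a vertex of C_n is the image of its rotations by
-- −k,…,k, so it has at most s vertices and every distance-k dominating multiset has at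
-- least ⌈n/s⌉ elements; guards at every s-th vertex (shifted by k, the last one clamped to
-- vertex n−1) attain this. They suffice eternally too: the rotations of a dominating
-- multiset dominate, and after an attack the guard within distance k of the attacked
-- vertex walks onto it while every other guard performs the same rotation.

open import Defs
open import Data.Nat using (ℕ; zero; suc; _+_; _*_; _∸_; _≤_; _<_; s≤s; s≤s⁻¹; _<?_; _⊓_)
open import Data.Nat.Properties
open import Data.Nat.DivMod using (_/_; _%_; m≡m%n+[m/n]*n; m%n<n; m/n*n≤m; m/n≡1+[m∸n]/n; m<n*o⇒m/o<n; /-monoˡ-≤)
open import Data.Fin using (Fin; toℕ; fromℕ<; fromℕ; inject₁; combine) renaming (zero to fz; suc to fs)
open import Data.Fin.Properties using (combine-injective; injective⇒≤; toℕ-injective; toℕ<n; toℕ-fromℕ<; toℕ-fromℕ; toℕ-inject₁)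
import Data.Fin.Permutation as Perm
open import Data.Vec using (Vec; lookup; tabulate)
open import Data.Vec.Properties using (lookup∘tabulate)
open import Data.Product using (Σ; ∃-syntax; _×_; _,_; proj₁; proj₂)
open import Data.Sum using (_⊎_; inj₁; inj₂)
open import Data.Empty using (⊥-elim)
open import Function.Base using (_∘_)
open import Function.Definitions using (StrictlySurjective)
open import Relation.Nullary using (yes; no)
open import Relation.Binary.PropositionalEquality

module _ {a} {A : Set a} where
  open import Function.Endo.Propositional A using (_^_)

  ^-strictlySurjective : ∀ {f : A → A} → StrictlySurjective _≡_ f → ∀ m → StrictlySurjective _≡_ (f ^ m)
  ^-strictlySurjective surj zero y = y , refl
  ^-strictlySurjective {f} surj (suc m) y with surj y
  ... | x , fx≡y with ^-strictlySurjective surj m x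
  ... | w , fᵐw≡x = w , trans (cong f fᵐw≡x) fx≡y

  ^-commute : ∀ {f g : A → A} → (∀ x → f (g x) ≡ g (f x)) → ∀ m x → f ((g ^ m) x) ≡ (g ^ m) (f x)
  ^-commute comm zero x = refl
  ^-commute {f} {g} comm (suc m) x = trans (comm ((g ^ m) x)) (cong g (^-commute comm m x))

module _ {n} (G : Graph n) where
  open import Function.Endo.Propositional (Fin n) using (_^_)

  PreservesAdj : (Fin n → Fin n) → Set
  PreservesAdj f = ∀ {u w} → Adj G u w → Adj G (f u) (f w)

  ^-preservesAdj : ∀ {f} → PreservesAdj f → ∀ m → PreservesAdj (f ^ m)
  ^-preservesAdj pres zero adj = adj
  ^-preservesAdj pres (suc m) adj = pres (^-preservesAdj pres m adj)

  Walk-map : ∀ {f} → PreservesAdj f → ∀ {m u w} → Walk G m u w → Walk G m (f u) (f w)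
  Walk-map pres here = here
  Walk-map pres (step adj W) = step (pres adj) (Walk-map pres W)

module Translates {n} (G : Graph n) {T : Set} (act : T → Fin n → Fin n)
  (ε : T) (act-ε : ∀ x → act ε x ≡ x)
  (act-preservesAdj : ∀ t → PreservesAdj G (act t))
  (act-surjective : ∀ t → StrictlySurjective _≡_ (act t))
  (act-liftsWalks : ∀ {m w} t x → Walk G m (act t x) w →
                    ∃[ t′ ] (w ≡ act t′ x × ∀ y → Walk G m (act t y) (act t′ y)))
  {k q : ℕ} (D₀ : Vec (Fin n) q) (D₀-dominating : IsDistDom G k D₀)
  where

  Translate : Vec (Fin n) q → Set
  Translate D = ∃[ t ] ∀ i → lookup D i ≡ act t (lookup D₀ i)

  translate-dominating : ∀ D → Translate D → IsDistDom G k D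
  translate-dominating D (t , D≡tD₀) v with act-surjective t v
  ... | u , tu≡v with D₀-dominating u
  ... | i , m , m≤k , W =
    i , m , m≤k , subst₂ (Walk G m) (sym (D≡tD₀ i)) tu≡v (Walk-map G (act-preservesAdj t) W)

  translate-defends : ∀ D → Translate D → ∀ v → ∃[ D' ] (Translate D' × v ∈ᴹ D' × Transforms G k D D')
  translate-defends D (t , D≡tD₀) v with translate-dominating D (t , D≡tD₀) v
  ... | i , m , m≤k , W with act-liftsWalks t (lookup D₀ i) (subst (λ u → Walk G m u v) (D≡tD₀ i) W)
  ... | t′ , v≡t′D₀ᵢ , follow =
    tabulate (act t′ ∘ lookup D₀) ,
    (t′ , lookup∘tabulate _) ,
    (i , trans (lookup∘tabulate _ i) (sym v≡t′D₀ᵢ)) ,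
    Perm.id , λ j → m , m≤k ,
      subst₂ (Walk G m) (sym (D≡tD₀ j)) (sym (lookup∘tabulate _ j)) (follow (lookup D₀ j))

  translates-eternal : IsEternalFamily G k Translate
  translates-eternal =
    (D₀ , ε , λ i → sym (act-ε _)) , translate-dominating , translate-defends

module _ {n} (G : Graph n) {k s : ℕ} (ball : Fin n → Fin s → Fin n)
  (ball-covers : ∀ {x v} → DistLe G k x v → ∃[ d ] ball x d ≡ v) where

  dominating-size : ∀ {q} (D : Vec (Fin n) q) → IsDistDom G k D → n ≤ q * s
  dominating-size {q} D dominating = injective⇒≤ code-injective
    where
    locate : ∀ v → Σ (Fin q × Fin s) λ (i , d) → ball (lookup D i) d ≡ v
    locate v with dominating v
    ... | i , i-near-v with ball-covers i-near-v
    ... | d , eq = (i , d) , eq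

    code : Fin n → Fin (q * s)
    code v = combine (proj₁ (proj₁ (locate v))) (proj₂ (proj₁ (locate v)))

    code-injective : ∀ {v w} → code v ≡ code w → v ≡ w
    code-injective {v} {w} eq
      with combine-injective (proj₁ (proj₁ (locate v))) (proj₂ (proj₁ (locate v)))
                             (proj₁ (proj₁ (locate w))) (proj₂ (proj₁ (locate w))) eq
    ... | i≡ , d≡ = trans (sym (proj₂ (locate v)))
                          (trans (cong₂ (λ i d → ball (lookup D i) d) i≡ d≡) (proj₂ (locate w)))

module CycleGraph (n : ℕ) where
  open import Function.Endo.Propositional (Fin (suc n)) using (_^_)

  G : Graph (suc n)
  G = Cycle (suc n)

  -- definitionally the successor relation inside CycleAdj
  Succ : Fin (suc n) → Fin (suc n) → Set
  Succ a b = (toℕ b ≡ suc (toℕ a)) ⊎ (suc (toℕ a) ≡ suc n × toℕ b ≡ 0)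

  Succ-functional : ∀ {a b c} → Succ a b → Succ a c → b ≡ c
  Succ-functional (inj₁ p) (inj₁ q) = toℕ-injective (trans p (sym q))
  Succ-functional {b = b} (inj₁ p) (inj₂ (q , _)) = ⊥-elim (<-irrefl (trans p q) (toℕ<n b))
  Succ-functional {c = c} (inj₂ (q , _)) (inj₁ p) = ⊥-elim (<-irrefl (trans p q) (toℕ<n c))
  Succ-functional (inj₂ (_ , p)) (inj₂ (_ , q)) = toℕ-injective (trans p (sym q))

  Succ-injective : ∀ {a b c} → Succ a c → Succ b c → a ≡ b
  Succ-injective (inj₁ p) (inj₁ q) = toℕ-injective (suc-injective (trans (sym p) q))
  Succ-injective (inj₁ p) (inj₂ (_ , q)) with () ← trans (sym p) q
  Succ-injective (inj₂ (_ , q)) (inj₁ p) with () ← trans (sym p) q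
  Succ-injective (inj₂ (p , _)) (inj₂ (q , _)) = toℕ-injective (suc-injective (trans p (sym q)))

  next : Fin (suc n) → Fin (suc n)
  next x with suc (toℕ x) <? suc n
  ... | yes x+1<N = fromℕ< x+1<N
  ... | no _ = fz

  Succ-next : ∀ x → Succ x (next x)
  Succ-next x with suc (toℕ x) <? suc n
  ... | yes x+1<N = inj₁ (toℕ-fromℕ< x+1<N)
  ... | no x+1≮N = inj₂ (≤-antisym (toℕ<n x) (≮⇒≥ x+1≮N) , refl)

  prev : Fin (suc n) → Fin (suc n)
  prev fz = fromℕ n
  prev (fs x) = inject₁ x

  Succ-prev : ∀ x → Succ (prev x) x
  Succ-prev fz = inj₂ (cong suc (toℕ-fromℕ n) , refl)
  Succ-prev (fs x) = inj₁ (cong suc (sym (toℕ-inject₁ x)))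

  next-prev : ∀ x → next (prev x) ≡ x
  next-prev x = Succ-functional (Succ-next (prev x)) (Succ-prev x)

  prev-next : ∀ x → prev (next x) ≡ x
  prev-next x = Succ-injective (Succ-prev (next x)) (Succ-next x)

  Adj-next : ∀ x → Adj G x (next x)
  Adj-next x = inj₁ (Succ-next x)

  Adj-prev : ∀ x → Adj G x (prev x)
  Adj-prev x = inj₂ (Succ-prev x)

  Adj⇒next⊎prev : ∀ {x y} → Adj G x y → y ≡ next x ⊎ y ≡ prev x
  Adj⇒next⊎prev {x} (inj₁ x→y) = inj₁ (Succ-functional x→y (Succ-next x))
  Adj⇒next⊎prev {x} (inj₂ y→x) = inj₂ (Succ-injective y→x (Succ-prev x))

  next-preservesAdj : PreservesAdj G next
  next-preservesAdj {x} adj with Adj⇒next⊎prev adj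
  ... | inj₁ refl = Adj-next (next x)
  ... | inj₂ refl = subst (Adj G (next x)) (trans (prev-next x) (sym (next-prev x))) (Adj-prev (next x))

  prev-preservesAdj : PreservesAdj G prev
  prev-preservesAdj {x} adj with Adj⇒next⊎prev adj
  ... | inj₁ refl = subst (Adj G (prev x)) (trans (next-prev x) (sym (prev-next x))) (Adj-next (prev x))
  ... | inj₂ refl = Adj-prev (prev x)

  -- rotation by a − b, kept as a pair to avoid integers
  rotate : ℕ × ℕ → Fin (suc n) → Fin (suc n)
  rotate (a , b) x = (next ^ a) ((prev ^ b) x)

  steps : ℕ × ℕ → ℕ
  steps (a , b) = a + b

  rotate-preservesAdj : ∀ r → PreservesAdj G (rotate r)
  rotate-preservesAdj (a , b) = ^-preservesAdj G next-preservesAdj a ∘ ^-preservesAdj G prev-preservesAdj b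

  rotate-surjective : ∀ r → StrictlySurjective _≡_ (rotate r)
  rotate-surjective (a , b) y with ^-strictlySurjective (λ x → prev x , next-prev x) a y
  ... | x , eq with ^-strictlySurjective (λ x → next x , prev-next x) b x
  ... | w , eq′ = w , trans (cong (next ^ a) eq′) eq

  prev-rotate : ∀ a b x → prev (rotate (a , b) x) ≡ rotate (a , suc b) x
  prev-rotate a b x = ^-commute (λ y → trans (prev-next y) (sym (next-prev y))) a ((prev ^ b) x)

  rotate-cancel : ∀ a b x → rotate (suc a , suc b) x ≡ rotate (a , b) x
  rotate-cancel a b x = trans (cong next (sym (prev-rotate a b x))) (next-prev (rotate (a , b) x))

  Adj-rotate : ∀ {r x y} → Adj G (rotate r x) y →
    ∃[ r′ ] (y ≡ rotate r′ x × steps r′ ≡ suc (steps r) × ∀ z → Adj G (rotate r z) (rotate r′ z))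
  Adj-rotate {a , b} {x} adj with Adj⇒next⊎prev adj
  ... | inj₁ refl = (suc a , b) , refl , refl , λ z → Adj-next (rotate (a , b) z)
  ... | inj₂ refl = (a , suc b) , prev-rotate a b x , +-suc a b ,
                    λ z → subst (Adj G _) (prev-rotate a b z) (Adj-prev (rotate (a , b) z))

  Walk-rotate : ∀ {m r x y} → Walk G m (rotate r x) y →
    ∃[ r′ ] (y ≡ rotate r′ x × steps r′ ≡ m + steps r × ∀ z → Walk G m (rotate r z) (rotate r′ z))
  Walk-rotate {r = r} here = r , refl , refl , λ z → here
  Walk-rotate {suc m} {r} {x} (step adj W) with Adj-rotate {r} adj
  ... | r₁ , refl , steps-r₁ , adjs with Walk-rotate {r = r₁} {x = x} W
  ... | r′ , y≡ , steps-r′ , walks =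
    r′ , y≡ , trans steps-r′ (trans (cong (m +_) steps-r₁) (+-suc m (steps r))) ,
    λ z → step (adjs z) (walks z)

  rotate-liftsWalks : ∀ {m y} r x → Walk G m (rotate r x) y →
    ∃[ r′ ] (y ≡ rotate r′ x × ∀ z → Walk G m (rotate r z) (rotate r′ z))
  rotate-liftsWalks r x W with Walk-rotate {r = r} {x = x} W
  ... | r′ , y≡ , _ , walks = r′ , y≡ , walks

  Walk-ascending : ∀ d {u v} → toℕ v ≡ d + toℕ u → Walk G d u v
  Walk-ascending zero eq = subst (Walk G 0 _) (toℕ-injective (sym eq)) here
  Walk-ascending (suc d) {u} {v} eq =
    step (inj₁ (inj₁ (toℕ-fromℕ< u+1<N)))
         (Walk-ascending d (trans eq (trans (sym (+-suc d (toℕ u))) (cong (d +_) (sym (toℕ-fromℕ< u+1<N))))))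
    where
    u+1<N : suc (toℕ u) < suc n
    u+1<N = ≤-<-trans (s≤s (m≤n+m (toℕ u) d)) (subst (_< suc n) eq (toℕ<n v))

  Walk-descending : ∀ d {u v} → toℕ u ≡ d + toℕ v → Walk G d u v
  Walk-descending zero eq = subst (Walk G 0 _) (toℕ-injective eq) here
  Walk-descending (suc d) {u} {v} eq =
    step (inj₂ (inj₁ (trans eq (cong suc (sym (toℕ-fromℕ< d+v<N))))))
         (Walk-descending d (toℕ-fromℕ< d+v<N))
    where
    d+v<N : d + toℕ v < suc n
    d+v<N = <-trans (n<1+n (d + toℕ v)) (subst (_< suc n) eq (toℕ<n u))

  DistLe-cycle : ∀ {k} u v → toℕ v ≤ toℕ u + k → toℕ u ≤ toℕ v + k → DistLe G k u v
  DistLe-cycle u v v≤u+k u≤v+k with ≤-total (toℕ u) (toℕ v)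
  ... | inj₁ u≤v = toℕ v ∸ toℕ u , m≤n+o⇒m∸n≤o (toℕ v) (toℕ u) v≤u+k ,
                   Walk-ascending (toℕ v ∸ toℕ u) (sym (m∸n+n≡m u≤v))
  ... | inj₂ v≤u = toℕ u ∸ toℕ v , m≤n+o⇒m∸n≤o (toℕ u) (toℕ v) u≤v+k ,
                   Walk-descending (toℕ u ∸ toℕ v) (sym (m∸n+n≡m v≤u))

  module _ (k : ℕ) where
    s : ℕ
    s = suc (2 * k)

    rotate-canonical : ∀ a b x → a + b ≤ k → ∃[ d ] (d < s × rotate (d ∸ k , k ∸ d) x ≡ rotate (a , b) x)
    rotate-canonical zero b x b≤k =
      k ∸ b , s≤s (≤-trans (m∸n≤m k b) (m≤m+n k (k + 0))) ,
      cong₂ (λ a′ b′ → rotate (a′ , b′) x) (m≤n⇒m∸n≡0 (m∸n≤m k b)) (m∸[m∸n]≡n b≤k)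
    rotate-canonical (suc a) zero x a+1≤k =
      k + suc a , s≤s (+-monoʳ-≤ k (≤-trans (subst (_≤ k) (+-identityʳ (suc a)) a+1≤k) (m≤m+n k 0))) ,
      cong₂ (λ a′ b′ → rotate (a′ , b′) x) (m+n∸m≡n k (suc a)) (m≤n⇒m∸n≡0 (m≤m+n k (suc a)))
    rotate-canonical (suc a) (suc b) x a+b+2≤k
      with rotate-canonical a b x (≤-trans (+-monoʳ-≤ a (n≤1+n b)) (≤-trans (n≤1+n _) a+b+2≤k))
    ... | d , d<s , eq = d , d<s , trans eq (sym (rotate-cancel a b x))

    ball : Fin (suc n) → Fin s → Fin (suc n)
    ball x d = rotate (toℕ d ∸ k , k ∸ toℕ d) x

    ball-covers : ∀ {x v} → DistLe G k x v → ∃[ d ] ball x d ≡ v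
    ball-covers {x} (m , m≤k , W) with Walk-rotate {r = 0 , 0} {x = x} W
    ... | (a , b) , v≡ , a+b≡m , _
      with rotate-canonical a b x (subst (_≤ k) (sym (trans a+b≡m (+-identityʳ m))) m≤k)
    ... | d , d<s , eq =
      fromℕ< d<s , trans (cong (λ d′ → rotate (d′ ∸ k , k ∸ d′) x) (toℕ-fromℕ< d<s)) (trans eq (sym v≡))

    dominating-size-cycle : ∀ {q} (D : Vec (Fin (suc n)) q) → IsDistDom G k D → suc (n / s) ≤ q
    dominating-size-cycle D dominating = m<n*o⇒m/o<n (dominating-size G ball ball-covers D dominating)

    guard : ℕ → Fin (suc n)
    guard j = fromℕ< (s≤s (m⊓n≤n (j * s + k) n))

    guards : Vec (Fin (suc n)) (suc (n / s))
    guards = tabulate (guard ∘ toℕ)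

    guards-dominating : IsDistDom G k guards
    guards-dominating v = i , subst (λ g → DistLe G k g v) (sym guard-i) (DistLe-cycle (guard q) v t≤p+k p≤t+k)
      where
      t q : ℕ
      t = toℕ v
      q = t / s
      t≤n : t ≤ n
      t≤n = s≤s⁻¹ (toℕ<n v)
      i : Fin (suc (n / s))
      i = fromℕ< (s≤s (/-monoˡ-≤ s t≤n))
      guard-i : lookup guards i ≡ guard q
      guard-i = trans (lookup∘tabulate (guard ∘ toℕ) i) (cong guard (toℕ-fromℕ< (s≤s (/-monoˡ-≤ s t≤n))))
      t≤qs+k+k : t ≤ q * s + k + k
      t≤qs+k+k = begin
        t                ≡⟨ m≡m%n+[m/n]*n t s ⟩
        t % s + q * s    ≤⟨ +-monoˡ-≤ (q * s) (s≤s⁻¹ (m%n<n t s)) ⟩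
        2 * k + q * s    ≡⟨ +-comm (2 * k) (q * s) ⟩
        q * s + 2 * k    ≡⟨ cong (λ k′ → q * s + (k + k′)) (+-identityʳ k) ⟩
        q * s + (k + k)  ≡⟨ +-assoc (q * s) k k ⟨
        q * s + k + k    ∎
        where open ≤-Reasoning
      t≤p+k : t ≤ toℕ (guard q) + k
      t≤p+k = subst (t ≤_) (trans (sym (+-distribʳ-⊓ k (q * s + k) n)) (cong (_+ k) (sym (toℕ-fromℕ< _))))
                    (⊓-glb t≤qs+k+k (≤-trans t≤n (m≤m+n n k)))
      p≤t+k : toℕ (guard q) ≤ t + k
      p≤t+k = subst (_≤ t + k) (sym (toℕ-fromℕ< _)) (≤-trans (m⊓n≤m (q * s + k) n) (+-monoˡ-≤ k (m/n*n≤m t s)))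

    guards-eternal : HasEternalFamily G k (suc (n / s))
    guards-eternal = Translate , translates-eternal
      where
      open Translates G rotate (0 , 0) (λ _ → refl) rotate-preservesAdj rotate-surjective
        rotate-liftsWalks guards guards-dominating

ceilDiv-suc : ∀ n k → ceilDiv (suc n) k ≡ suc (n / suc (2 * k))
ceilDiv-suc n k = trans (m/n≡1+[m∸n]/n (s≤s (m≤n+m (2 * k) n)))
                        (cong (λ m → suc (m / suc (2 * k))) (m+n∸n≡m n (2 * k)))

theorem1 : ∀ (n k : ℕ) → 3 ≤ n → 1 ≤ k →
    EternalDomNumberIs (Cycle n) k (ceilDiv n k) × DomNumberIs (Cycle n) k (ceilDiv n k)
theorem1 (suc n) k _ _ rewrite ceilDiv-suc n k =
  (guards-eternal k , λ q (_ , (D , D∈E) , dominating , _) → dominating-size-cycle k D (dominating D D∈E)) ,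
  ((guards k , guards-dominating k) , λ q (D , dominating) → dominating-size-cycle k D dominating)
  where open CycleGraph n
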